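{- Let $p$ be a prime with $p-1=2^iq_1^{j_1}q_2^{j_2}$, where $q_1\neq q_2$ are odd primes and $i,j_1,j_2\ge 1$. Let $g$ be a generator of $\mathbb{Z}_p^*$. For any $g_1,g_2\in\mathcal{M}(g)$, $\mathcal{M}(g_1)=\mathcal{M}(g_2)$.
   Context: $\mathcal{G}$ is the set of generators of $\mathbb{Z}_p^*$, $\mathcal{R}$ the set of quadratic residues in $\mathbb{Z}_p^*$. For $g\in\mathcal{G}$: $\mathcal{R}_g=\{r\in\mathcal{R}: gr\in\mathcal{G}\}$, $\mathcal{I}(g)=\mathcal{R}_g\cap\mathcal{R}_{g^{ -1}}$, $\mathcal{M}(g)=\mathcal{G}\setminus\{gr,\ g^{ -1}r : r\in\mathcal{I}(g)\}$ (products mod $p$). -}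

module Defs where

open import Data.Nat using (ℕ; _*_; _^_; _%_; _≤_; _<_; _∸_; NonZero)
open import Data.Product using (Σ; _×_; ∃; ∃-syntax)
open import Data.Sum using (_⊎_)
open import Relation.Nullary using (¬_)
open import Relation.Binary.PropositionalEquality using (_≡_; _≢_)

-- Elements of ℤ_p^* are represented by natural numbers x with 1 ≤ x < p;
-- multiplication is (x * y) % p.

module _ (p : ℕ) .{{_ : NonZero p}} where

  Unit : ℕ → Set
  Unit x = 1 ≤ x × x < p

  IsGenerator : ℕ → Set
  IsGenerator x = Unit x × ((k : ℕ) → 1 ≤ k → k < p ∸ 1 → x ^ k % p ≢ 1)

  IsQR : ℕ → Set
  IsQR r = Unit r × ∃[ y ] (Unit y × (y * y) % p ≡ r)

  IsInverse : ℕ → ℕ → Set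
  IsInverse g h = Unit h × (g * h) % p ≡ 1

  InRg : ℕ → ℕ → Set
  InRg g r = IsQR r × IsGenerator ((g * r) % p)

  InI : ℕ → ℕ → Set
  InI g r = InRg g r × ((h : ℕ) → IsInverse g h → InRg h r)

  InM : ℕ → ℕ → Set
  InM g x = IsGenerator x ×
    ¬ (∃[ r ] (InI g r ×
         (x ≡ (g * r) % p ⊎ ((h : ℕ) → IsInverse g h → x ≡ (h * r) % p))))

{-# OPTIONS --safe #-}
module Submission where

-- Every unit is a power g^e, and g^e is a generator iff e is prime to n = p - 1; the quadratic
-- residues are the g^(2f), and g^a has inverse g^b with n ∣ a + b. Unwinding the definitions,
-- g^u ∈ ℳ(g^a) iff u is prime to n while u + 2a and u + 2b are not. As u is odd, this says
-- that q₁ or q₂ divides each of u ± 2a, and since neither divides 4a, that u ≡ ±2a (mod q₁)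
-- and u ≡ ∓2a (mod q₂). For g₁ = g^a ∈ ℳ(g) this means a ≡ ±2 (mod q₁), a ≡ ∓2 (mod q₂);
-- substituting, g^u ∈ ℳ(g₁) iff u is prime to n and u ≡ 4 modulo both q₁ and q₂ or u ≡ -4
-- modulo both, a condition that does not depend on g₁.

open import Defs
open import Data.Nat using (ℕ; NonZero; _*_; _^_; _∸_; _≤_)
open import Data.Nat.Primality using (Prime)
open import Data.Product using (_×_)
open import Relation.Binary.PropositionalEquality using (_≡_; _≢_)

open import Data.Nat.Base using (zero; suc; _+_; _<_; _%_; pred; z<s; z≤n; s≤s)
open import Data.Nat.Base using (>-nonZero; >-nonZero⁻¹; ≢-nonZero⁻¹; nonTrivial⇒n>1; n>1⇒nonTrivial)
open import Data.Nat.Properties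
open import Data.Nat.DivMod using (_/_; m≡m%n+[m/n]*n; m%n<n; m<n⇒m%n≡m; m%n%n≡m%n)
open import Data.Nat.DivMod using (%-distribˡ-+; %-distribˡ-*; %-remove-+ʳ)
open import Data.Nat.Divisibility
open import Data.Nat.Coprimality using (Coprime; coprime-divisor; 1-coprimeTo) renaming (sym to coprime-sym)
open import Data.Nat.Primality using (prime[2]; ¬prime[1]; euclidsLemma; prime⇒irreducible; prime⇒nonTrivial)
import Data.Nat.Tactic.RingSolver as ℕ-Solver
open import Data.Integer as ℤ using (ℤ; +_; -_)
open import Data.Integer.Properties using (pos-+; pos-*; neg-involutive)
open import Data.Integer.Divisibility.Signed as ℤ∣ using (∣ᵤ⇒∣; ∣⇒∣ᵤ) renaming (_∣_ to _∣ℤ_)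
import Data.Integer.Tactic.RingSolver as ℤ-Solver
open import Data.Empty using (⊥-elim)
open import Data.Fin using (Fin; toℕ; fromℕ<; punchOut) renaming (_≟_ to _≟ᶠ_)
open import Data.Fin.Properties using (any?; injective⇒≤; punchOut-injective)
open import Data.Fin.Properties using (toℕ<n; toℕ-fromℕ<; toℕ-injective; fromℕ<-injective)
open import Data.Product using (_,_; proj₁; proj₂; ∃-syntax; swap)
open import Data.Product.Function.NonDependent.Propositional using (_×-⇔_)
open import Data.Sum using (_⊎_; inj₁; inj₂; [_,_]′)
open import Data.Sum.Function.Propositional using (_⊎-⇔_)
import Data.Sum as Sum
open import Function using (_∘_; id; flip)
open import Function.Bundles using (_⇔_; mk⇔; module Equivalence)
open import Function.Construct.Composition using (_⇔-∘_)
open import Function.Construct.Identity using (⇔-id)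
open import Function.Definitions using (Injective)
open import Relation.Nullary using (¬_; yes; no; contradiction)
open import Relation.Binary.PropositionalEquality using (refl; sym; trans; cong; cong₂; subst; module ≡-Reasoning)

open Equivalence using (to; from)

fin-injective⇒surjective : ∀ {m} (f : Fin m → Fin m) → Injective _≡_ _≡_ f → ∀ y → ∃[ x ] f x ≡ y
fin-injective⇒surjective {suc m} f f-injective y with any? (λ x → f x ≟ᶠ y)
... | yes found = found
... | no ¬found = contradiction (injective⇒≤ punchOut∘f-injective) 1+n≰n
  where
  y≢f : ∀ x → y ≢ f x
  y≢f x y≡fx = ¬found (x , sym y≡fx)

  punchOut∘f-injective : Injective _≡_ _≡_ (λ x → punchOut (y≢f x))
  punchOut∘f-injective eq = f-injective (punchOut-injective (y≢f _) (y≢f _) eq)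

<-injective⇒surjective : ∀ {m} (f : ℕ → ℕ) → (∀ {k} → k < m → f k < m) →
  (∀ {a b} → a < m → b < m → f a ≡ f b → a ≡ b) →
  ∀ {y} → y < m → ∃[ x ] x < m × f x ≡ y
<-injective⇒surjective {m} f f<m f-injective {y} y<m =
  let x , Fx≡y = fin-injective⇒surjective F F-injective (fromℕ< y<m)
  in toℕ x , toℕ<n x , (begin
    f (toℕ x)             ≡⟨ toℕ-fromℕ< (f<m (toℕ<n x)) ⟨
    toℕ (F x)             ≡⟨ cong toℕ Fx≡y ⟩
    toℕ (fromℕ< y<m)      ≡⟨ toℕ-fromℕ< y<m ⟩
    y                     ∎)
  where
  open ≡-Reasoning

  F : Fin m → Fin m
  F k = fromℕ< (f<m (toℕ<n k))

  F-injective : Injective _≡_ _≡_ F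
  F-injective eq = toℕ-injective (f-injective (toℕ<n _) (toℕ<n _) (fromℕ<-injective _ _ _ _ eq))

∣m+n∣n⇒∣m : ∀ {d m n} → d ∣ m + n → d ∣ n → d ∣ m
∣m+n∣n⇒∣m {d} {m} {n} d∣m+n d∣n = ∣m+n∣m⇒∣n (subst (d ∣_) (+-comm m n) d∣m+n) d∣n

m∣m^k : ∀ {m k} → 1 ≤ k → m ∣ m ^ k
m∣m^k {m} {suc k} _ = m∣m*n (m ^ k)

odd⇒%2≡1 : ∀ {m} → ¬ 2 ∣ m → m % 2 ≡ 1
odd⇒%2≡1 {m} 2∤m with m % 2 | m%n<n m 2 | m%n≡0⇒n∣m m 2
... | zero        | _             | 2∣m = contradiction (2∣m refl) 2∤m
... | suc zero    | _             | _   = refl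
... | suc (suc _) | s≤s (s≤s ()) | _

odd+odd⇒even : ∀ {m n} → ¬ 2 ∣ m → ¬ 2 ∣ n → 2 ∣ m + n
odd+odd⇒even {m} {n} 2∤m 2∤n = m%n≡0⇒n∣m (m + n) 2 (begin
  (m + n) % 2              ≡⟨ %-distribˡ-+ m n 2 ⟩
  (m % 2 + n % 2) % 2      ≡⟨ cong₂ (λ x y → (x + y) % 2) (odd⇒%2≡1 2∤m) (odd⇒%2≡1 2∤n) ⟩
  0                        ∎)
  where open ≡-Reasoning

m%d≡n%d⇒d∣n∸m : ∀ m n d .{{_ : NonZero d}} → m % d ≡ n % d → d ∣ n ∸ m
m%d≡n%d⇒d∣n∸m m n d eq = divides (n / d ∸ m / d) (begin
  n ∸ m                                      ≡⟨ cong₂ _∸_ (m≡m%n+[m/n]*n n d) (m≡m%n+[m/n]*n m d) ⟩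
  (n % d + n / d * d) ∸ (m % d + m / d * d)  ≡⟨ cong (λ r → (r + n / d * d) ∸ (m % d + m / d * d)) eq ⟨
  (m % d + n / d * d) ∸ (m % d + m / d * d)  ≡⟨ [m+n]∸[m+o]≡n∸o (m % d) _ _ ⟩
  n / d * d ∸ m / d * d                      ≡⟨ *-distribʳ-∸ d (n / d) (m / d) ⟨
  (n / d ∸ m / d) * d                        ∎)
  where open ≡-Reasoning

*-cancelˡ-% : ∀ {d z} .{{_ : NonZero d}} → Prime d → ¬ d ∣ z →
  ∀ x y → z * x % d ≡ z * y % d → x % d ≡ y % d
*-cancelˡ-% {d} {z} d-prime d∤z x y eq =
  [ cancel eq , (λ y≤x → sym (cancel (sym eq) y≤x)) ]′ (≤-total x y)
  where
  cancel : ∀ {x y} → z * x % d ≡ z * y % d → x ≤ y → x % d ≡ y % d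
  cancel {x} {y} eq x≤y = begin
    x % d              ≡⟨ %-remove-+ʳ x d∣y∸x ⟨
    (x + (y ∸ x)) % d  ≡⟨ cong (_% d) (m+[n∸m]≡n x≤y) ⟩
    y % d              ∎
    where
    open ≡-Reasoning
    d∣z*[y∸x] : d ∣ z * (y ∸ x)
    d∣z*[y∸x] = subst (d ∣_) (sym (*-distribˡ-∸ z y x)) (m%d≡n%d⇒d∣n∸m (z * x) (z * y) d eq)

    d∣y∸x : d ∣ y ∸ x
    d∣y∸x = [ flip contradiction d∤z , id ]′ (euclidsLemma z (y ∸ x) d-prime d∣z*[y∸x])

[m%d]^k%d≡m^k%d : ∀ m k d .{{_ : NonZero d}} → (m % d) ^ k % d ≡ m ^ k % d
[m%d]^k%d≡m^k%d m zero    d = refl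
[m%d]^k%d≡m^k%d m (suc k) d = begin
  (m % d) * (m % d) ^ k % d            ≡⟨ %-distribˡ-* (m % d) _ d ⟩
  (m % d % d) * ((m % d) ^ k % d) % d  ≡⟨ cong₂ (λ x y → x * y % d) (m%n%n≡m%n m d) ([m%d]^k%d≡m^k%d m k d) ⟩
  (m % d) * (m ^ k % d) % d            ≡⟨ %-distribˡ-* m (m ^ k) d ⟨
  m * m ^ k % d                        ∎
  where open ≡-Reasoning

prime∤⇒∤^ : ∀ {d m} → Prime d → ¬ d ∣ m → ∀ k → ¬ d ∣ m ^ k
prime∤⇒∤^ d-prime d∤m zero    d∣1     = ¬prime[1] (subst Prime (∣1⇒≡1 d∣1) d-prime)
prime∤⇒∤^ d-prime d∤m (suc k) d∣m^1+k =
  [ d∤m , prime∤⇒∤^ d-prime d∤m k ]′ (euclidsLemma _ _ d-prime d∣m^1+k)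

coprime-* : ∀ {m n o} → Coprime m n → Coprime m o → Coprime m (n * o)
coprime-* c₁ c₂ (d∣m , d∣n*o) =
  c₂ (d∣m , coprime-divisor (λ (k∣d , k∣n) → c₁ (∣-trans k∣d d∣m , k∣n)) d∣n*o)

coprime-^ : ∀ {m n} → Coprime m n → ∀ k → Coprime m (n ^ k)
coprime-^ c zero    (_ , d∣1) = ∣1⇒≡1 d∣1
coprime-^ c (suc k)           = coprime-* c (coprime-^ c k)

prime∤⇒coprime : ∀ {q m} → Prime q → ¬ q ∣ m → Coprime m q
prime∤⇒coprime q-prime q∤m {d} (d∣m , d∣q) with prime⇒irreducible q-prime d∣q
... | inj₁ d≡1  = d≡1
... | inj₂ refl = contradiction d∣m q∤m

prime∣⇒¬coprime : ∀ {q m n} → Prime q → q ∣ m → q ∣ n → ¬ Coprime m n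
prime∣⇒¬coprime q-prime q∣m q∣n c = ¬prime[1] (subst Prime (c (q∣m , q∣n)) q-prime)

odd-prime∤4 : ∀ {q} → Prime q → q ≢ 2 → ¬ q ∣ 4
odd-prime∤4 q-prime q≢2 q∣4 with prime⇒irreducible prime[2] ([ id , id ]′ (euclidsLemma 2 2 q-prime q∣4))
... | inj₁ refl = ¬prime[1] q-prime
... | inj₂ q≡2  = q≢2 q≡2

-- A record rather than a function, so that x and y can be inferred from a proof.
infix 4 _≡_mod_
record _≡_mod_ (x y : ℤ) (q : ℕ) : Set where
  constructor ∣⇒≡-mod
  field ≡-mod⇒∣ : + q ∣ℤ x ℤ.- y
open _≡_mod_

module _ {q : ℕ} where

  ≡-mod-sym : ∀ {x y} → x ≡ y mod q → y ≡ x mod q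
  ≡-mod-sym {x} {y} (∣⇒≡-mod q∣x-y) = ∣⇒≡-mod (subst (_ ∣ℤ_) (identity x y) (ℤ∣.∣m⇒∣-m q∣x-y))
    where
    identity : ∀ x y → - (x ℤ.- y) ≡ y ℤ.- x
    identity = ℤ-Solver.solve-∀

  ≡-mod-trans : ∀ {x y z} → x ≡ y mod q → y ≡ z mod q → x ≡ z mod q
  ≡-mod-trans {x} {y} {z} (∣⇒≡-mod q∣x-y) (∣⇒≡-mod q∣y-z) =
    ∣⇒≡-mod (subst (_ ∣ℤ_) (identity x y z) (ℤ∣.∣m∣n⇒∣m+n q∣x-y q∣y-z))
    where
    identity : ∀ x y z → (x ℤ.- y) ℤ.+ (y ℤ.- z) ≡ x ℤ.- z
    identity = ℤ-Solver.solve-∀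

  *-congˡ-mod : ∀ k {x y} → x ≡ y mod q → k ℤ.* x ≡ k ℤ.* y mod q
  *-congˡ-mod k {x} {y} (∣⇒≡-mod q∣x-y) = ∣⇒≡-mod (subst (_ ∣ℤ_) (identity k x y) (ℤ∣.∣n⇒∣m*n k q∣x-y))
    where
    identity : ∀ k x y → k ℤ.* (x ℤ.- y) ≡ k ℤ.* x ℤ.- k ℤ.* y
    identity = ℤ-Solver.solve-∀

  neg-cong-mod : ∀ {x y} → x ≡ y mod q → - x ≡ - y mod q
  neg-cong-mod {x} {y} (∣⇒≡-mod q∣x-y) = ∣⇒≡-mod (subst (_ ∣ℤ_) (identity x y) (ℤ∣.∣m⇒∣-m q∣x-y))
    where
    identity : ∀ x y → - (x ℤ.- y) ≡ - x ℤ.- - y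
    identity = ℤ-Solver.solve-∀

  ∣+⇔≡-neg : ∀ {x y} → q ∣ x + y ⇔ + x ≡ - + y mod q
  ∣+⇔≡-neg {x} {y} = mk⇔ (∣⇒≡-mod ∘ subst (_ ∣ℤ_) (sym x+y) ∘ ∣ᵤ⇒∣) (∣⇒∣ᵤ ∘ subst (_ ∣ℤ_) x+y ∘ ≡-mod⇒∣)
    where
    x+y : + x ℤ.- - + y ≡ + (x + y)
    x+y = trans (cong (ℤ._+_ (+ x)) (neg-involutive (+ y))) (sym (pos-+ x y))

  odd-prime∤⇒2a≢-2a : ∀ {a} → Prime q → q ≢ 2 → ¬ q ∣ a → ¬ (+ 2 ℤ.* + a ≡ - (+ 2 ℤ.* + a) mod q)
  odd-prime∤⇒2a≢-2a {a} q-prime q≢2 q∤a 2a≡-2a =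
    [ odd-prime∤4 q-prime q≢2 , q∤a ]′ (euclidsLemma 4 a q-prime (∣⇒∣ᵤ (subst (_ ∣ℤ_) 4a (≡-mod⇒∣ 2a≡-2a))))
    where
    identity : ∀ x → + 2 ℤ.* x ℤ.- - (+ 2 ℤ.* x) ≡ + 4 ℤ.* x
    identity = ℤ-Solver.solve-∀
    4a : + 2 ℤ.* + a ℤ.- - (+ 2 ℤ.* + a) ≡ + (4 * a)
    4a = trans (identity (+ a)) (sym (pos-* 4 a))

module SignPatterns (q₁ q₂ : ℕ) where

  EitherCongruent : ℤ → ℤ → Set
  EitherCongruent d x = x ≡ d mod q₁ ⊎ x ≡ d mod q₂

  OppositeSigns : ℤ → ℤ → Set
  OppositeSigns d x = (x ≡ d mod q₁ × x ≡ - d mod q₂) ⊎ (x ≡ - d mod q₁ × x ≡ d mod q₂)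

  SameSigns : ℤ → ℤ → Set
  SameSigns d x = (x ≡ d mod q₁ × x ≡ d mod q₂) ⊎ (x ≡ - d mod q₁ × x ≡ - d mod q₂)

  eitherCongruent-resp : ∀ {d d′ x} → d ≡ d′ mod q₁ → d ≡ d′ mod q₂ → EitherCongruent d x → EitherCongruent d′ x
  eitherCongruent-resp d≡d′ _ (inj₁ x≡d) = inj₁ (≡-mod-trans x≡d d≡d′)
  eitherCongruent-resp _ d≡d′ (inj₂ x≡d) = inj₂ (≡-mod-trans x≡d d≡d′)

  eitherCongruent±⇒oppositeSigns : ∀ {d x} → ¬ d ≡ - d mod q₁ → ¬ d ≡ - d mod q₂ →
    EitherCongruent d x → EitherCongruent (- d) x → OppositeSigns d x
  eitherCongruent±⇒oppositeSigns d≢-d _ (inj₁ x≡d) (inj₁ x≡-d) = ⊥-elim (d≢-d (≡-mod-trans (≡-mod-sym x≡d) x≡-d))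
  eitherCongruent±⇒oppositeSigns _ _    (inj₁ x≡d) (inj₂ x≡-d) = inj₁ (x≡d , x≡-d)
  eitherCongruent±⇒oppositeSigns _ _    (inj₂ x≡d) (inj₁ x≡-d) = inj₂ (x≡-d , x≡d)
  eitherCongruent±⇒oppositeSigns _ d≢-d (inj₂ x≡d) (inj₂ x≡-d) = ⊥-elim (d≢-d (≡-mod-trans (≡-mod-sym x≡d) x≡-d))

  oppositeSigns⇒eitherCongruent± : ∀ {d x} → OppositeSigns d x → EitherCongruent d x × EitherCongruent (- d) x
  oppositeSigns⇒eitherCongruent± (inj₁ (x≡d , x≡-d)) = inj₁ x≡d , inj₂ x≡-d
  oppositeSigns⇒eitherCongruent± (inj₂ (x≡-d , x≡d)) = inj₂ x≡d , inj₁ x≡-d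

  oppositeSigns[2a]⇔sameSigns[4] : ∀ {a x} → OppositeSigns (+ 2) a →
    OppositeSigns (+ 2 ℤ.* a) x ⇔ SameSigns (+ 4) x
  oppositeSigns[2a]⇔sameSigns[4] {a} {x} a-signs = mk⇔ (⇒ a-signs) (⇐ a-signs)
    where
    scale : ∀ {q a c} → a ≡ c mod q → x ≡ + 2 ℤ.* a mod q → x ≡ + 2 ℤ.* c mod q
    scale a≡c x≡2a = ≡-mod-trans x≡2a (*-congˡ-mod (+ 2) a≡c)

    scale⁻ : ∀ {q a c} → a ≡ c mod q → x ≡ - (+ 2 ℤ.* a) mod q → x ≡ - (+ 2 ℤ.* c) mod q
    scale⁻ a≡c x≡-2a = ≡-mod-trans x≡-2a (neg-cong-mod (*-congˡ-mod (+ 2) a≡c))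

    -- Here and in ⇐, products of signed literals such as - (+ 2 ℤ.* - + 2) reduce to ± 4.
    ⇒ : OppositeSigns (+ 2) a → OppositeSigns (+ 2 ℤ.* a) x → SameSigns (+ 4) x
    ⇒ (inj₁ (a₁ , a₂)) (inj₁ (x₁ , x₂)) = inj₁ (scale a₁ x₁ , scale⁻ a₂ x₂)
    ⇒ (inj₁ (a₁ , a₂)) (inj₂ (x₁ , x₂)) = inj₂ (scale⁻ a₁ x₁ , scale a₂ x₂)
    ⇒ (inj₂ (a₁ , a₂)) (inj₁ (x₁ , x₂)) = inj₂ (scale a₁ x₁ , scale⁻ a₂ x₂)
    ⇒ (inj₂ (a₁ , a₂)) (inj₂ (x₁ , x₂)) = inj₁ (scale⁻ a₁ x₁ , scale a₂ x₂)

    ⇐ : OppositeSigns (+ 2) a → SameSigns (+ 4) x → OppositeSigns (+ 2 ℤ.* a) x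
    ⇐ (inj₁ (a₁ , a₂)) (inj₁ (x₁ , x₂)) = inj₁ (scale (≡-mod-sym a₁) x₁ , scale⁻ (≡-mod-sym a₂) x₂)
    ⇐ (inj₁ (a₁ , a₂)) (inj₂ (x₁ , x₂)) = inj₂ (scale⁻ (≡-mod-sym a₁) x₁ , scale (≡-mod-sym a₂) x₂)
    ⇐ (inj₂ (a₁ , a₂)) (inj₁ (x₁ , x₂)) = inj₂ (scale⁻ (≡-mod-sym a₁) x₁ , scale (≡-mod-sym a₂) x₂)
    ⇐ (inj₂ (a₁ , a₂)) (inj₂ (x₁ , x₂)) = inj₁ (scale (≡-mod-sym a₁) x₁ , scale⁻ (≡-mod-sym a₂) x₂)

module Powers (p : ℕ) .{{_ : NonZero p}} (p-prime : Prime p) (g : ℕ) (g-generator : IsGenerator p g) where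

  open ≡-Reasoning

  n : ℕ
  n = p ∸ 1

  1<p : 1 < p
  1<p = nonTrivial⇒n>1 p {{prime⇒nonTrivial p-prime}}

  instance
    n-nonZero : NonZero n
    n-nonZero = >-nonZero (m<n⇒0<n∸m 1<p)

  1%p≡1 : 1 % p ≡ 1
  1%p≡1 = m<n⇒m%n≡m 1<p

  p∤g : ¬ p ∣ g
  p∤g p∣g = <⇒≱ g<p (∣⇒≤ {{>-nonZero 1≤g}} p∣g)
    where
    1≤g = proj₁ (proj₁ g-generator)
    g<p = proj₂ (proj₁ g-generator)

  -- Opaque, so that unification can read an exponent e off pow e.
  opaque
    pow : ℕ → ℕ
    pow e = g ^ e % p

  opaque
    unfolding pow

    order : ∀ {k} → 0 < k → k < n → pow k ≢ 1
    order {k} = proj₂ g-generator k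

    pow-unit : ∀ e → Unit p (pow e)
    pow-unit e = n≢0⇒n>0 (prime∤⇒∤^ p-prime p∤g e ∘ m%n≡0⇒n∣m (g ^ e) p) , m%n<n (g ^ e) p

    pow-0 : pow 0 ≡ 1
    pow-0 = 1%p≡1

    pow-1 : pow 1 ≡ g
    pow-1 = trans (cong (_% p) (*-identityʳ g)) (m<n⇒m%n≡m (proj₂ (proj₁ g-generator)))

    pow-+ : ∀ a b → pow (a + b) ≡ pow a * pow b % p
    pow-+ a b = trans (cong (_% p) (^-distribˡ-+-* g a b)) (%-distribˡ-* (g ^ a) (g ^ b) p)

    pow-^ : ∀ e k → pow e ^ k % p ≡ pow (e * k)
    pow-^ e k = trans ([m%d]^k%d≡m^k%d (g ^ e) k p) (cong (_% p) (^-*-assoc g e k))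

    pow≡pow⇒pow[∸]≡1 : ∀ {a b} → a ≤ b → pow a ≡ pow b → pow (b ∸ a) ≡ 1
    pow≡pow⇒pow[∸]≡1 {a} {b} a≤b eq = trans (sym cancelled) 1%p≡1
      where
      cancelled : 1 % p ≡ pow (b ∸ a)
      cancelled = *-cancelˡ-% p-prime (prime∤⇒∤^ p-prime p∤g a) 1 (g ^ (b ∸ a)) (begin
        g ^ a * 1 % p              ≡⟨ cong (_% p) (*-identityʳ (g ^ a)) ⟩
        pow a                      ≡⟨ eq ⟩
        pow b                      ≡⟨ cong pow (m+[n∸m]≡n a≤b) ⟨
        pow (a + (b ∸ a))          ≡⟨ cong (_% p) (^-distribˡ-+-* g a (b ∸ a)) ⟩
        g ^ a * g ^ (b ∸ a) % p    ∎)

    pow-% : ∀ e → pow e % p ≡ pow e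
    pow-% e = m%n%n≡m%n (g ^ e) p

  pow≡1⇒≡0 : ∀ {k} → k < n → pow k ≡ 1 → k ≡ 0
  pow≡1⇒≡0 {zero}  _   _  = refl
  pow≡1⇒≡0 {suc k} k<n eq = contradiction eq (order z<s k<n)

  pow-injective : ∀ {a b} → a < n → b < n → pow a ≡ pow b → a ≡ b
  pow-injective {a} {b} a<n b<n eq =
    [ (λ a≤b → injective a≤b b<n eq) , (λ b≤a → sym (injective b≤a a<n (sym eq))) ]′ (≤-total a b)
    where
    injective : ∀ {a b} → a ≤ b → b < n → pow a ≡ pow b → a ≡ b
    injective {a} {b} a≤b b<n eq = ≤-antisym a≤b (m∸n≡0⇒m≤n
      (pow≡1⇒≡0 (≤-<-trans (m∸n≤m b a) b<n) (pow≡pow⇒pow[∸]≡1 a≤b eq)))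

  pow-surjective : ∀ {x} → Unit p x → ∃[ e ] e < n × pow e ≡ x
  pow-surjective {x} (1≤x , x<p) =
    let e , e<n , eq = <-injective⇒surjective (pred ∘ pow) pred-pow<n pred-pow-injective
                         (pred-mono-< {{>-nonZero 1≤x}} x<p)
    in e , e<n , pred-injective {{>-nonZero (proj₁ (pow-unit e))}} {{>-nonZero 1≤x}} eq
    where
    pred-pow<n : ∀ {k} → k < n → pred (pow k) < n
    pred-pow<n {k} _ = pred-mono-< {{>-nonZero (proj₁ (pow-unit k))}} (proj₂ (pow-unit k))

    pred-pow-injective : ∀ {a b} → a < n → b < n → pred (pow a) ≡ pred (pow b) → a ≡ b
    pred-pow-injective {a} {b} a<n b<n eq = pow-injective a<n b<n
      (pred-injective {{>-nonZero (proj₁ (pow-unit a))}} {{>-nonZero (proj₁ (pow-unit b))}} eq)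

  pow[n]≡1 : pow n ≡ 1
  pow[n]≡1 with pow-surjective (pow-unit n)
  ... | zero  , _   , pow[0]≡pow[n] = trans (sym pow[0]≡pow[n]) pow-0
  ... | suc e , e<n , eq = contradiction (pow≡pow⇒pow[∸]≡1 (<⇒≤ e<n) eq)
                             (order (m<n⇒0<n∸m e<n) (∸-monoʳ-< z<s (<⇒≤ e<n)))

  ∣⇒pow≡1 : ∀ {e} → n ∣ e → pow e ≡ 1
  ∣⇒pow≡1 (divides k refl) = begin
    pow (k * n)      ≡⟨ cong pow (*-comm k n) ⟩
    pow (n * k)      ≡⟨ pow-^ n k ⟨
    pow n ^ k % p    ≡⟨ cong (λ x → x ^ k % p) pow[n]≡1 ⟩
    1 ^ k % p        ≡⟨ cong (_% p) (^-zeroˡ k) ⟩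
    1 % p            ≡⟨ 1%p≡1 ⟩
    1                ∎

  pow-periodic : ∀ {d} e → n ∣ d → pow (e + d) ≡ pow e
  pow-periodic {d} e n∣d = begin
    pow (e + d)          ≡⟨ pow-+ e d ⟩
    pow e * pow d % p    ≡⟨ cong (λ x → pow e * x % p) (∣⇒pow≡1 n∣d) ⟩
    pow e * 1 % p        ≡⟨ cong (_% p) (*-identityʳ (pow e)) ⟩
    pow e % p            ≡⟨ pow-% e ⟩
    pow e                ∎

  pow≡1⇒∣ : ∀ {e} → pow e ≡ 1 → n ∣ e
  pow≡1⇒∣ {e} eq = m%n≡0⇒n∣m e n (pow≡1⇒≡0 (m%n<n e n) (begin
    pow (e % n)                  ≡⟨ pow-periodic (e % n) (n∣m*n (e / n)) ⟨
    pow (e % n + e / n * n)      ≡⟨ cong pow (m≡m%n+[m/n]*n e n) ⟨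
    pow e                        ≡⟨ eq ⟩
    1                            ∎))

  ∣-order⇒¬isGenerator : ∀ {d e} → 1 < d → d ∣ e → d ∣ n → ¬ IsGenerator p (pow e)
  ∣-order⇒¬isGenerator {d} {e} 1<d d∣e d∣n (_ , pow-e-order) =
    pow-e-order k (>-nonZero⁻¹ k) k<n (trans (pow-^ e k) (∣⇒pow≡1 n∣e*k))
    where
    k = quotient d∣n
    instance
      k-nonZero : NonZero k
      k-nonZero = quotient≢0 d∣n
    k<n : k < n
    k<n = quotient-< d∣n {{n>1⇒nonTrivial 1<d}}
    n∣e*k : n ∣ e * k
    n∣e*k = subst (_∣ e * k) (sym (m∣n⇒n≡m*quotient d∣n)) (*-monoˡ-∣ k d∣e)

  isGenerator⇒coprime : ∀ {e} → IsGenerator p (pow e) → Coprime e n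
  isGenerator⇒coprime _   {zero}        (_ , 0∣n)   = contradiction (0∣⇒≡0 0∣n) (≢-nonZero⁻¹ n)
  isGenerator⇒coprime _   {suc zero}    _           = refl
  isGenerator⇒coprime gen {suc (suc d)} (d∣e , d∣n) =
    contradiction gen (∣-order⇒¬isGenerator (s≤s (s≤s z≤n)) d∣e d∣n)

  coprime⇒isGenerator : ∀ {e} → Coprime e n → IsGenerator p (pow e)
  coprime⇒isGenerator {e} c = pow-unit e , λ k 0<k k<n pow-e^k≡1 →
    let n∣e*k = pow≡1⇒∣ (trans (sym (pow-^ e k)) pow-e^k≡1)
    in <⇒≱ k<n (∣⇒≤ {{>-nonZero 0<k}} (coprime-divisor (coprime-sym c) n∣e*k))

  isGenerator[pow*pow]⇔coprime : ∀ a e → IsGenerator p (pow a * pow e % p) ⇔ Coprime (a + e) n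
  isGenerator[pow*pow]⇔coprime a e =
    subst (λ x → IsGenerator p x ⇔ Coprime (a + e) n) (pow-+ a e) (mk⇔ isGenerator⇒coprime coprime⇒isGenerator)

  coprime-resp-pow : ∀ {a b} → pow a ≡ pow b → Coprime a n → Coprime b n
  coprime-resp-pow eq = isGenerator⇒coprime ∘ subst (IsGenerator p) eq ∘ coprime⇒isGenerator

  inverse-exponent : ∀ a → n ∣ a + (n ∸ 1) * a
  inverse-exponent a = subst (λ m → n ∣ m * a) (sym (suc-pred n)) (m∣m*n a)

  isQR⇔ : ∀ {r} → IsQR p r ⇔ (∃[ f ] r ≡ pow (2 * f))
  isQR⇔ = mk⇔ ⇒ ⇐
    where
    pow-double : ∀ f → pow f * pow f % p ≡ pow (2 * f)
    pow-double f = trans (sym (pow-+ f f)) (cong (λ m → pow (f + m)) (sym (+-identityʳ f)))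

    ⇒ : ∀ {r} → IsQR p r → ∃[ f ] r ≡ pow (2 * f)
    ⇒ (_ , y , y-unit , refl) with pow-surjective y-unit
    ... | f , _ , refl = f , pow-double f

    ⇐ : ∀ {r} → ∃[ f ] r ≡ pow (2 * f) → IsQR p r
    ⇐ (f , refl) = pow-unit (2 * f) , pow f , pow-unit f , pow-double f

  isInverse⇔ : ∀ a b {h} → n ∣ a + b → IsInverse p (pow a) h ⇔ h ≡ pow b
  isInverse⇔ a b n∣a+b = mk⇔ ⇒ ⇐
    where
    inverse-unique : ∀ {b′} → n ∣ a + b′ → pow b′ ≡ pow b
    inverse-unique {b′} n∣a+b′ = begin
      pow b′                ≡⟨ pow-periodic b′ n∣a+b ⟨
      pow (b′ + (a + b))    ≡⟨ cong pow (rearrange b′ a b) ⟩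
      pow (b + (a + b′))    ≡⟨ pow-periodic b n∣a+b′ ⟩
      pow b                 ∎
      where
      rearrange : ∀ x y z → x + (y + z) ≡ z + (y + x)
      rearrange = ℕ-Solver.solve-∀

    ⇒ : ∀ {h} → IsInverse p (pow a) h → h ≡ pow b
    ⇒ (h-unit , pow-a*h≡1) with pow-surjective h-unit
    ... | b′ , _ , refl = inverse-unique (pow≡1⇒∣ (trans (pow-+ a b′) pow-a*h≡1))

    ⇐ : ∀ {h} → h ≡ pow b → IsInverse p (pow a) h
    ⇐ refl = pow-unit b , trans (sym (pow-+ a b)) (∣⇒pow≡1 n∣a+b)

  -- g^(2f) ∈ ℐ(g^a), where g^b = (g^a)⁻¹
  InI-exponent : ℕ → ℕ → ℕ → Set
  InI-exponent a b f = Coprime (a + 2 * f) n × Coprime (b + 2 * f) n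

  inI⇔ : ∀ a b {r} → n ∣ a + b → InI p (pow a) r ⇔ (∃[ f ] (r ≡ pow (2 * f) × InI-exponent a b f))
  inI⇔ a b n∣a+b = mk⇔ ⇒ ⇐
    where
    generator⇔ : ∀ c f → IsGenerator p (pow c * pow (2 * f) % p) ⇔ Coprime (c + 2 * f) n
    generator⇔ c f = isGenerator[pow*pow]⇔coprime c (2 * f)

    ⇒ : ∀ {r} → InI p (pow a) r → ∃[ f ] (r ≡ pow (2 * f) × InI-exponent a b f)
    ⇒ ((r-qr , a·r-generator) , inverse·r-inRg) with to isQR⇔ r-qr
    ... | f , refl = f , refl , to (generator⇔ a f) a·r-generator
                   , to (generator⇔ b f) (proj₂ (inverse·r-inRg (pow b) (from (isInverse⇔ a b n∣a+b) refl)))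

    ⇐ : ∀ {r} → ∃[ f ] (r ≡ pow (2 * f) × InI-exponent a b f) → InI p (pow a) r
    ⇐ (f , refl , a+2f-coprime , b+2f-coprime) =
      (r-qr , from (generator⇔ a f) a+2f-coprime) , λ h h-inverse →
        r-qr , subst (λ h → IsGenerator p (h * pow (2 * f) % p)) (sym (to (isInverse⇔ a b n∣a+b) h-inverse))
                 (from (generator⇔ b f) b+2f-coprime)
      where r-qr = from isQR⇔ (f , refl)

  Excluded : ℕ → ℕ → Set
  Excluded g x = ∃[ r ] (InI p g r × (x ≡ (g * r) % p ⊎ ((h : ℕ) → IsInverse p g h → x ≡ (h * r) % p)))

  excluded⇔ : ∀ a b {x} → n ∣ a + b →
    Excluded (pow a) x ⇔ (∃[ f ] (InI-exponent a b f × (x ≡ pow (a + 2 * f) ⊎ x ≡ pow (b + 2 * f))))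
  excluded⇔ a b n∣a+b = mk⇔ ⇒ ⇐
    where
    ⇒ : ∀ {x} → Excluded (pow a) x → ∃[ f ] (InI-exponent a b f × (x ≡ pow (a + 2 * f) ⊎ x ≡ pow (b + 2 * f)))
    ⇒ (r , r∈I , x∈) with to (inI⇔ a b n∣a+b) r∈I
    ... | f , refl , f∈I = f , f∈I , Sum.map
      (λ x≡a·r → trans x≡a·r (sym (pow-+ a (2 * f))))
      (λ x≡h·r → trans (x≡h·r (pow b) (from (isInverse⇔ a b n∣a+b) refl)) (sym (pow-+ b (2 * f))))
      x∈

    ⇐ : ∀ {x} → ∃[ f ] (InI-exponent a b f × (x ≡ pow (a + 2 * f) ⊎ x ≡ pow (b + 2 * f))) → Excluded (pow a) x
    ⇐ (f , f∈I , x∈) = pow (2 * f) , from (inI⇔ a b n∣a+b) (f , refl , f∈I) , Sum.map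
      (λ x≡ → trans x≡ (pow-+ a (2 * f)))
      (λ x≡ h h-inverse → trans x≡ (trans (pow-+ b (2 * f))
        (cong (λ h → h * pow (2 * f) % p) (sym (to (isInverse⇔ a b n∣a+b) h-inverse)))))
      x∈

  pow[u]≡pow[a+e]⇒pow[u+2b]≡pow[b+e] : ∀ a b {u e} → n ∣ a + b → pow u ≡ pow (a + e) → pow (u + 2 * b) ≡ pow (b + e)
  pow[u]≡pow[a+e]⇒pow[u+2b]≡pow[b+e] a b {u} {e} n∣a+b eq = begin
    pow (u + 2 * b)                ≡⟨ pow-+ u (2 * b) ⟩
    pow u * pow (2 * b) % p        ≡⟨ cong (λ x → x * pow (2 * b) % p) eq ⟩
    pow (a + e) * pow (2 * b) % p  ≡⟨ pow-+ (a + e) (2 * b) ⟨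
    pow (a + e + 2 * b)            ≡⟨ cong pow (rearrange a b e) ⟩
    pow (b + e + (a + b))          ≡⟨ pow-periodic (b + e) n∣a+b ⟩
    pow (b + e)                    ∎
    where
    rearrange : ∀ a b e → a + e + 2 * b ≡ b + e + (a + b)
    rearrange = ℕ-Solver.solve-∀

  u+b≡2f⇒pow[u]≡pow[a+2f] : ∀ a b {u} f → n ∣ a + b → u + b ≡ 2 * f → pow u ≡ pow (a + 2 * f)
  u+b≡2f⇒pow[u]≡pow[a+2f] a b {u} f n∣a+b u+b≡2f = begin
    pow u                ≡⟨ pow-periodic u n∣a+b ⟨
    pow (u + (a + b))    ≡⟨ cong pow (rearrange u a b) ⟩
    pow (a + (u + b))    ≡⟨ cong (λ m → pow (a + m)) u+b≡2f ⟩
    pow (a + 2 * f)      ∎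
    where
    rearrange : ∀ u a b → u + (a + b) ≡ a + (u + b)
    rearrange = ℕ-Solver.solve-∀

  module _ (2∣n : 2 ∣ n) where

    coprime⇒odd : ∀ {e} → Coprime e n → ¬ 2 ∣ e
    coprime⇒odd c 2∣e = prime∣⇒¬coprime prime[2] 2∣e 2∣n c

    excluded⇔coprime : ∀ a b {u} → Coprime a n → n ∣ a + b → Coprime u n →
      Excluded (pow a) (pow u) ⇔ (Coprime (u + 2 * b) n ⊎ Coprime (u + 2 * a) n)
    excluded⇔coprime a b {u} a-coprime n∣a+b u-coprime = mk⇔ ⇒ ⇐ ⇔-∘ excluded⇔ a b n∣a+b
      where
      n∣b+a : n ∣ b + a
      n∣b+a = subst (n ∣_) (+-comm a b) n∣a+b

      b-odd : ¬ 2 ∣ b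
      b-odd 2∣b = coprime⇒odd a-coprime (∣m+n∣n⇒∣m (∣-trans 2∣n n∣a+b) 2∣b)

      ⇒ : ∃[ f ] (InI-exponent a b f × (pow u ≡ pow (a + 2 * f) ⊎ pow u ≡ pow (b + 2 * f))) →
          Coprime (u + 2 * b) n ⊎ Coprime (u + 2 * a) n
      ⇒ (f , (_ , b+2f-coprime) , inj₁ eq) =
        inj₁ (coprime-resp-pow (sym (pow[u]≡pow[a+e]⇒pow[u+2b]≡pow[b+e] a b n∣a+b eq)) b+2f-coprime)
      ⇒ (f , (a+2f-coprime , _) , inj₂ eq) =
        inj₂ (coprime-resp-pow (sym (pow[u]≡pow[a+e]⇒pow[u+2b]≡pow[b+e] b a n∣b+a eq)) a+2f-coprime)

      -- f = (u + b) / 2, so that g^u = g^a g^(2f)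
      witness : ∀ a b → n ∣ a + b → ¬ 2 ∣ b → Coprime (u + 2 * b) n →
        ∃[ f ] (InI-exponent a b f × pow u ≡ pow (a + 2 * f))
      witness a b n∣a+b b-odd u+2b-coprime =
        f , (coprime-resp-pow u≡ u-coprime , subst (λ m → Coprime m n) (sym b+2f≡u+2b) u+2b-coprime) , u≡
        where
        2∣u+b = odd+odd⇒even (coprime⇒odd u-coprime) b-odd
        f = quotient 2∣u+b
        u+b≡2f = m∣n⇒n≡m*quotient 2∣u+b
        u≡ = u+b≡2f⇒pow[u]≡pow[a+2f] a b f n∣a+b u+b≡2f
        double : ∀ u b → b + (u + b) ≡ u + 2 * b
        double = ℕ-Solver.solve-∀
        b+2f≡u+2b : b + 2 * f ≡ u + 2 * b
        b+2f≡u+2b = trans (cong (_+_ b) (sym u+b≡2f)) (double u b)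

      ⇐ : Coprime (u + 2 * b) n ⊎ Coprime (u + 2 * a) n →
          ∃[ f ] (InI-exponent a b f × (pow u ≡ pow (a + 2 * f) ⊎ pow u ≡ pow (b + 2 * f)))
      ⇐ (inj₁ c) with witness a b n∣a+b b-odd c
      ... | f , f∈I , eq = f , f∈I , inj₁ eq
      ⇐ (inj₂ c) with witness b a n∣b+a (coprime⇒odd a-coprime) c
      ... | f , f∈I , eq = f , swap f∈I , inj₂ eq

    inM⇔ : ∀ a b {u} → Coprime a n → n ∣ a + b →
      InM p (pow a) (pow u) ⇔ (Coprime u n × ¬ Coprime (u + 2 * a) n × ¬ Coprime (u + 2 * b) n)
    inM⇔ a b {u} a-coprime n∣a+b = mk⇔ ⇒ ⇐
      where
      ⇒ : InM p (pow a) (pow u) → Coprime u n × ¬ Coprime (u + 2 * a) n × ¬ Coprime (u + 2 * b) n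
      ⇒ (u-generator , not-excluded) =
        u-coprime , not-excluded ∘ from excluded ∘ inj₂ , not-excluded ∘ from excluded ∘ inj₁
        where
        u-coprime = isGenerator⇒coprime u-generator
        excluded = excluded⇔coprime a b a-coprime n∣a+b u-coprime

      ⇐ : Coprime u n × ¬ Coprime (u + 2 * a) n × ¬ Coprime (u + 2 * b) n → InM p (pow a) (pow u)
      ⇐ (u-coprime , u+2a-not-coprime , u+2b-not-coprime) =
        coprime⇒isGenerator u-coprime ,
        [ u+2b-not-coprime , u+2a-not-coprime ]′ ∘ to (excluded⇔coprime a b a-coprime n∣a+b u-coprime)

module PrimePowerFactors {n i j₁ j₂ q₁ q₂ : ℕ} (q₁-prime : Prime q₁) (q₂-prime : Prime q₂)
  (1≤i : 1 ≤ i) (1≤j₁ : 1 ≤ j₁) (1≤j₂ : 1 ≤ j₂) (n≡ : n ≡ 2 ^ i * q₁ ^ j₁ * q₂ ^ j₂) where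

  2∣n : 2 ∣ n
  2∣n = subst (2 ∣_) (sym n≡) (∣m⇒∣m*n (q₂ ^ j₂) (∣m⇒∣m*n (q₁ ^ j₁) (m∣m^k 1≤i)))

  q₁∣n : q₁ ∣ n
  q₁∣n = subst (q₁ ∣_) (sym n≡) (∣m⇒∣m*n (q₂ ^ j₂) (∣n⇒∣m*n (2 ^ i) (m∣m^k 1≤j₁)))

  q₂∣n : q₂ ∣ n
  q₂∣n = subst (q₂ ∣_) (sym n≡) (∣n⇒∣m*n (2 ^ i * q₁ ^ j₁) (m∣m^k 1≤j₂))

  odd∧∤⇒coprime : ∀ {e} → ¬ 2 ∣ e → ¬ q₁ ∣ e → ¬ q₂ ∣ e → Coprime e n
  odd∧∤⇒coprime 2∤e q₁∤e q₂∤e = subst (Coprime _) (sym n≡)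
    (coprime-* (coprime-* (coprime-^ (prime∤⇒coprime prime[2] 2∤e) i)
                          (coprime-^ (prime∤⇒coprime q₁-prime q₁∤e) j₁))
               (coprime-^ (prime∤⇒coprime q₂-prime q₂∤e) j₂))

  ¬coprime⇔∣ : ∀ {e} → ¬ 2 ∣ e → (¬ Coprime e n) ⇔ (q₁ ∣ e ⊎ q₂ ∣ e)
  ¬coprime⇔∣ {e} 2∤e = mk⇔ ⇒
    [ (λ q₁∣e → prime∣⇒¬coprime q₁-prime q₁∣e q₁∣n) , (λ q₂∣e → prime∣⇒¬coprime q₂-prime q₂∣e q₂∣n) ]′
    where
    ⇒ : ¬ Coprime e n → q₁ ∣ e ⊎ q₂ ∣ e
    ⇒ ¬coprime with q₁ ∣? e | q₂ ∣? e
    ... | yes q₁∣e | _        = inj₁ q₁∣e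
    ... | no _     | yes q₂∣e = inj₂ q₂∣e
    ... | no q₁∤e  | no q₂∤e  = ⊥-elim (¬coprime (odd∧∤⇒coprime 2∤e q₁∤e q₂∤e))

module Main (p : ℕ) .{{_ : NonZero p}} (p-prime : Prime p) (g : ℕ) (g-generator : IsGenerator p g)
  {i j₁ j₂ q₁ q₂ : ℕ} (q₁-prime : Prime q₁) (q₂-prime : Prime q₂) (q₁≢2 : q₁ ≢ 2) (q₂≢2 : q₂ ≢ 2)
  (1≤i : 1 ≤ i) (1≤j₁ : 1 ≤ j₁) (1≤j₂ : 1 ≤ j₂) (n≡ : p ∸ 1 ≡ 2 ^ i * q₁ ^ j₁ * q₂ ^ j₂) where

  open Powers p p-prime g g-generator
  open PrimePowerFactors q₁-prime q₂-prime 1≤i 1≤j₁ 1≤j₂ n≡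
  open SignPatterns q₁ q₂

  ¬coprime[u+2a]⇔eitherCongruent : ∀ a {u} → ¬ 2 ∣ u →
    (¬ Coprime (u + 2 * a) n) ⇔ EitherCongruent (- (+ 2 ℤ.* + a)) (+ u)
  ¬coprime[u+2a]⇔eitherCongruent a {u} 2∤u =
    subst (λ d → (¬ Coprime (u + 2 * a) n) ⇔ EitherCongruent (- d) (+ u)) (pos-* 2 a)
      ((∣+⇔≡-neg ⊎-⇔ ∣+⇔≡-neg) ⇔-∘ ¬coprime⇔∣ 2∤u+2a)
    where
    2∤u+2a : ¬ 2 ∣ u + 2 * a
    2∤u+2a 2∣u+2a = 2∤u (∣m+n∣n⇒∣m 2∣u+2a (m∣m*n a))

  ¬coprime[u+2b]⇔eitherCongruent : ∀ a b {u} → n ∣ a + b → ¬ 2 ∣ u →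
    (¬ Coprime (u + 2 * b) n) ⇔ EitherCongruent (+ 2 ℤ.* + a) (+ u)
  ¬coprime[u+2b]⇔eitherCongruent a b {u} n∣a+b 2∤u =
    mk⇔ (eitherCongruent-resp (-2b≡2a q₁∣n) (-2b≡2a q₂∣n))
        (eitherCongruent-resp (≡-mod-sym (-2b≡2a q₁∣n)) (≡-mod-sym (-2b≡2a q₂∣n)))
      ⇔-∘ ¬coprime[u+2a]⇔eitherCongruent b 2∤u
    where
    identity : ∀ x → - (+ 2 ℤ.* - x) ≡ + 2 ℤ.* x
    identity = ℤ-Solver.solve-∀

    -2b≡2a : ∀ {q} → q ∣ n → - (+ 2 ℤ.* + b) ≡ + 2 ℤ.* + a mod q
    -2b≡2a q∣n = subst (λ y → - (+ 2 ℤ.* + b) ≡ y mod _) (identity (+ a))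
      (neg-cong-mod (*-congˡ-mod (+ 2) (to ∣+⇔≡-neg (∣-trans q∣n (subst (n ∣_) (+-comm a b) n∣a+b)))))

  inM⇔oppositeSigns : ∀ a b {u} → Coprime a n → n ∣ a + b →
    InM p (pow a) (pow u) ⇔ (Coprime u n × OppositeSigns (+ 2 ℤ.* + a) (+ u))
  inM⇔oppositeSigns a b {u} a-coprime n∣a+b = mk⇔ ⇒ ⇐ ⇔-∘ inM⇔ 2∣n a b a-coprime n∣a+b
    where
    2a≢-2a : ∀ {q} → Prime q → q ≢ 2 → q ∣ n → ¬ (+ 2 ℤ.* + a ≡ - (+ 2 ℤ.* + a) mod q)
    2a≢-2a q-prime q≢2 q∣n =
      odd-prime∤⇒2a≢-2a q-prime q≢2 (λ q∣a → prime∣⇒¬coprime q-prime q∣a q∣n a-coprime)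

    ⇒ : Coprime u n × ¬ Coprime (u + 2 * a) n × ¬ Coprime (u + 2 * b) n →
        Coprime u n × OppositeSigns (+ 2 ℤ.* + a) (+ u)
    ⇒ (u-coprime , u+2a-not-coprime , u+2b-not-coprime) =
      u-coprime , eitherCongruent±⇒oppositeSigns (2a≢-2a q₁-prime q₁≢2 q₁∣n) (2a≢-2a q₂-prime q₂≢2 q₂∣n)
                    (to (¬coprime[u+2b]⇔eitherCongruent a b n∣a+b 2∤u) u+2b-not-coprime)
                    (to (¬coprime[u+2a]⇔eitherCongruent a 2∤u) u+2a-not-coprime)
      where 2∤u = coprime⇒odd 2∣n u-coprime

    ⇐ : Coprime u n × OppositeSigns (+ 2 ℤ.* + a) (+ u) →
        Coprime u n × ¬ Coprime (u + 2 * a) n × ¬ Coprime (u + 2 * b) n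
    ⇐ (u-coprime , u-signs) =
      u-coprime , from (¬coprime[u+2a]⇔eitherCongruent a 2∤u) (proj₂ congruent±)
                , from (¬coprime[u+2b]⇔eitherCongruent a b n∣a+b 2∤u) (proj₁ congruent±)
      where
      2∤u = coprime⇒odd 2∣n u-coprime
      congruent± = oppositeSigns⇒eitherCongruent± u-signs

  inM[inM]⇔sameSigns : ∀ {a u} → InM p g (pow a) →
    InM p (pow a) (pow u) ⇔ (Coprime u n × SameSigns (+ 4) (+ u))
  inM[inM]⇔sameSigns {a} a∈M
    with to (inM⇔oppositeSigns 1 ((n ∸ 1) * 1) (1-coprimeTo n) (inverse-exponent 1))
            (subst (λ h → InM p h (pow a)) (sym pow-1) a∈M)
  ... | a-coprime , a-signs =
    (⇔-id _ ×-⇔ oppositeSigns[2a]⇔sameSigns[4] a-signs)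
      ⇔-∘ inM⇔oppositeSigns a ((n ∸ 1) * a) a-coprime (inverse-exponent a)

  inM-transfer : ∀ {g₁ g₂ x} → InM p g g₁ → InM p g g₂ → InM p g₁ x → InM p g₂ x
  inM-transfer g₁∈M g₂∈M x∈M₁
    with pow-surjective (proj₁ (proj₁ g₁∈M)) | pow-surjective (proj₁ (proj₁ g₂∈M))
       | pow-surjective (proj₁ (proj₁ x∈M₁))
  ... | _ , _ , refl | _ , _ , refl | _ , _ , refl =
    from (inM[inM]⇔sameSigns g₂∈M) (to (inM[inM]⇔sameSigns g₁∈M) x∈M₁)

lemma6 : (p : ℕ) .{{_ : NonZero p}} → Prime p →
    (i j₁ j₂ q₁ q₂ : ℕ) → Prime q₁ → Prime q₂ →
    q₁ ≢ 2 → q₂ ≢ 2 → q₁ ≢ q₂ → 1 ≤ i → 1 ≤ j₁ → 1 ≤ j₂ →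
    p ∸ 1 ≡ 2 ^ i * q₁ ^ j₁ * q₂ ^ j₂ →
    (g : ℕ) → IsGenerator p g →
    (g₁ g₂ : ℕ) → InM p g g₁ → InM p g g₂ →
    (x : ℕ) → (InM p g₁ x → InM p g₂ x) × (InM p g₂ x → InM p g₁ x)
lemma6 p p-prime i j₁ j₂ q₁ q₂ q₁-prime q₂-prime q₁≢2 q₂≢2 _ 1≤i 1≤j₁ 1≤j₂ n≡ g g-generator g₁ g₂ g₁∈M g₂∈M x =
  inM-transfer g₁∈M g₂∈M , inM-transfer g₂∈M g₁∈M
  where open Main p p-prime g g-generator q₁-prime q₂-prime q₁≢2 q₂≢2 1≤i 1≤j₁ 1≤j₂ n≡
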